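{- Let $n\ge 8$. Then the set $\{\eta(\Gamma(G)) : \Gamma(G) \text{ an unbalanced signed graph whose underlying graph } G \text{ is a bicyclic graph on } n \text{ vertices}\}$ equals $\{0,1,2,\ldots,n-4\}$.
   Context: A signed graph $\Gamma(G)=(G,\sigma)$ consists of a simple graph $G$ and a map $\sigma:E(G)\to\{+,-\}$; its adjacency matrix has entry $\sigma(v_iv_j)$ for edges and $0$ otherwise, and $\eta(\Gamma(G))$ is the multiplicity of $0$ as an eigenvalue. A cycle is positive if it has an even number of negative edges; $\Gamma(G)$ is balanced if all its cycles are positive, and unbalanced otherwise. A bicyclic graph is a connected simple graph with $|E|=|V|+1$. -}

module Defs where

open import Data.Bool using (Bool; true; false; if_then_else_; T)
open import Data.Nat using (ℕ; zero; suc; _+_; _≤_; _<_; _%_; _<ᵇ_)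
open import Data.Fin using (Fin; toℕ)
open import Data.Integer as ℤ using (ℤ; +_; -[1+_])
open import Data.Rational as ℚ using (ℚ; 0ℚ; _/_)
open import Data.List using (List; []; _∷_; _++_; length; [_])
open import Data.List.Relation.Unary.All using (All)
open import Data.List.Relation.Unary.Unique.Propositional using (Unique)
open import Data.Product using (Σ; ∃; _×_; _,_)
open import Data.Empty using (⊥)
open import Relation.Binary.PropositionalEquality using (_≡_)
open import Relation.Nullary using (¬_)

record Graph (n : ℕ) : Set where
  field
    adj   : Fin n → Fin n → Bool
    sym   : ∀ i j → adj i j ≡ adj j i
    irrefl : ∀ i → adj i i ≡ false
open Graph public

data Reach {n : ℕ} (G : Graph n) : Fin n → Fin n → Set where
  here : ∀ {i} → Reach G i i
  step : ∀ {i j k} → T (adj G i j) → Reach G j k → Reach G i k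

Connected : {n : ℕ} → Graph n → Set
Connected G = ∀ i j → Reach G i j

∑ℕ : {m : ℕ} → (Fin m → ℕ) → ℕ
∑ℕ {zero}  f = 0
∑ℕ {suc m} f = f Data.Fin.zero + ∑ℕ (λ i → f (Data.Fin.suc i))

edgeCount : {n : ℕ} → Graph n → ℕ
edgeCount G = ∑ℕ (λ i → ∑ℕ (λ j →
  if (toℕ i <ᵇ toℕ j) then (if adj G i j then 1 else 0) else 0))

Bicyclic : {n : ℕ} → Graph n → Set
Bicyclic {n} G = Connected G × (edgeCount G ≡ n + 1)

data Sign : Set where
  plus minus : Sign

signℤ : Sign → ℤ
signℤ plus  = + 1
signℤ minus = -[1+ 0 ]

record SignedGraph (n : ℕ) : Set where
  field
    graph : Graph n
    σ     : Fin n → Fin n → Sign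
    σ-sym : ∀ i j → σ i j ≡ σ j i
open SignedGraph public

adjMatrix : {n : ℕ} → SignedGraph n → Fin n → Fin n → ℤ
adjMatrix Γ i j = if adj (graph Γ) i j then signℤ (σ Γ i j) else + 0

consecutive : {A : Set} → List A → List (A × A)
consecutive []            = []
consecutive (x ∷ [])      = []
consecutive (x ∷ y ∷ xs)  = (x , y) ∷ consecutive (y ∷ xs)

cycleEdges : {n : ℕ} → List (Fin n) → List (Fin n × Fin n)
cycleEdges []       = []
cycleEdges (v ∷ vs) = consecutive ((v ∷ vs) ++ [ v ])

IsEdge : {n : ℕ} → Graph n → Fin n × Fin n → Set
IsEdge G (i , j) = T (adj G i j)

IsCycle : {n : ℕ} → Graph n → List (Fin n) → Set
IsCycle G vs = (3 ≤ length vs) × Unique vs × All (IsEdge G) (cycleEdges vs)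

negCount : {n : ℕ} → SignedGraph n → List (Fin n × Fin n) → ℕ
negCount Γ []             = 0
negCount Γ ((i , j) ∷ es) with σ Γ i j
... | plus  = negCount Γ es
... | minus = suc (negCount Γ es)

PositiveCycle : {n : ℕ} → SignedGraph n → List (Fin n) → Set
PositiveCycle Γ vs = negCount Γ (cycleEdges vs) % 2 ≡ 0

Balanced : {n : ℕ} → SignedGraph n → Set
Balanced Γ = ∀ vs → IsCycle (graph Γ) vs → PositiveCycle Γ vs

Unbalanced : {n : ℕ} → SignedGraph n → Set
Unbalanced Γ = ¬ Balanced Γ

∑ℚ : {m : ℕ} → (Fin m → ℚ) → ℚ
∑ℚ {zero}  f = 0ℚ
∑ℚ {suc m} f = f Data.Fin.zero ℚ.+ ∑ℚ (λ i → f (Data.Fin.suc i))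

Vecℚ : ℕ → Set
Vecℚ n = Fin n → ℚ

mulVec : {n : ℕ} → (Fin n → Fin n → ℤ) → Vecℚ n → Vecℚ n
mulVec M x i = ∑ℚ (λ j → (M i j / 1) ℚ.* x j)

InKernel : {n : ℕ} → (Fin n → Fin n → ℤ) → Vecℚ n → Set
InKernel M x = ∀ i → mulVec M x i ≡ 0ℚ

LinIndep : {n k : ℕ} → (Fin k → Vecℚ n) → Set
LinIndep {n} {k} v =
  ∀ (c : Fin k → ℚ) → (∀ j → ∑ℚ (λ i → c i ℚ.* v i j) ≡ 0ℚ) → ∀ i → c i ≡ 0ℚ

KernelDim : {n : ℕ} → (Fin n → Fin n → ℤ) → ℕ → Set
KernelDim {n} M k =
  (Σ (Fin k → Vecℚ n) λ v → LinIndep v × (∀ i → InKernel M (v i)))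
  × (∀ (w : Fin (suc k) → Vecℚ n) → (∀ i → InKernel M (w i)) → ¬ LinIndep w)

Nullity : {n : ℕ} → SignedGraph n → ℕ → Set
Nullity Γ k = KernelDim (adjMatrix Γ) k

{-# OPTIONS --safe #-}
module Submission where

-- Upper bound. A bicyclic graph on n ≥ 8 vertices has an edge ab and a vertex w adjacent to
-- neither. Otherwise, if u and v are distinct and non-adjacent, every neighbour of u is adjacent
-- to every non-neighbour of u, and counting the edges across this cut shows that there are not
-- exactly n + 1 edges; a complete graph has too many. With c a neighbour of w, the rows of w, a, b
-- and c, in this order, force a kernel vector that vanishes outside {w, c, a, b} to vanish at c,
-- b, a and w. So independent kernel vectors stay independent on the other n - 4 coordinates, and
-- Gaussian elimination bounds their number by n - 4.
--
-- Lower bound. Joining a new vertex to the neighbour of a pendant vertex (a twin of the pendant)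
-- raises the nullity by one, and attaching a pendant path of length two keeps it; both keep the
-- graph bicyclic and unbalanced. Starting from three small graphs built on a signed diamond K₄ - e,
-- of nullity 0 on 5 and on 6 vertices and of nullity 1 on 5 vertices, they reach every pair (n, k)
-- with k ≤ n - 4.

open import Defs hiding (sym)

open import Algebra.Bundles using (Ring)
import Algebra.Properties.Semiring.Sum as Sum
open import Algebra.Properties.CommutativeSemigroup using (x∙yz≈y∙xz)
open import Data.Bool as Bool using (Bool; true; false; not; _∨_; if_then_else_; T)
open import Data.Bool.Properties using (T-≡; ∨-comm; not-¬; ¬-not)
import Data.Empty as Empty
open import Data.Fin as Fin using (Fin; zero; suc; punchIn; toℕ)
open import Data.Fin.Patterns using (0F; 1F; 2F; 3F; 4F; 5F)
open import Data.Fin.Properties using (any?; all?; punchInᵢ≢i; toℕ-injective; suc-injective)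
open import Data.Fin.Subset using (Subset; inside; outside; _∈_; ∣_∣; ⊥; ⊤; ∁; _∪_; _-_; ⁅_⁆)
open import Data.Fin.Subset.Properties
  using (_∈?_; ∈⊤; x∈p∪q⁻; x∈⁅y⁆⇒x≡y; x∈p⇒∣p-x∣<∣p∣; x∈p∧x≢y⇒x∈p-y; ∣⊥∣≡0; ∣⊤∣≡n; ∣∁p∣≡n∸∣p∣; ∣p∣≤n)
open import Data.Integer using (ℤ; 0ℤ)
open import Data.List as List using (List; []; _∷_; _++_; [_])
import Data.List.Properties as ListP
open import Data.List.Relation.Unary.All using (All; []; _∷_)
import Data.List.Relation.Unary.All.Properties as AllP
open import Data.List.Relation.Unary.AllPairs using ([]; _∷_)
import Data.List.Relation.Unary.Unique.Propositional.Properties as UniqueP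
open import Data.Nat as ℕ using (ℕ; zero; suc; _≤_; _∸_; z≤n; s≤s)
import Data.Nat.Properties as ℕP
open import Data.Nat.Tactic.RingSolver using (solve-∀)
open import Data.Product as Product using (Σ; _×_; _,_; proj₁; proj₂)
open import Data.Rational as ℚ using (ℚ; 0ℚ; 1ℚ; ½; _+_; _*_; -_)
import Data.Rational.Properties as ℚP
open import Data.Rational.Solver using (module +-*-Solver)
open import Data.Sum using (_⊎_; inj₁; inj₂; map₂)
open import Data.Vec using (Vec; _∷_; []; here; there; lookup; tabulate)
open import Data.Vec.Functional using (tail; insertAt) renaming (_∷_ to _∷ᶠ_)
open import Data.Vec.Functional.Properties using (insertAt-lookup; insertAt-punchIn)
open import Data.Vec.Properties using (lookup⇒[]=; lookup-map; lookup∘tabulate)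
open import Function using (_∘_)
open import Function.Bundles using (Equivalence; _⇔_; mk⇔)
open import Relation.Binary.Definitions using (tri<; tri≈; tri>)
open import Relation.Binary.PropositionalEquality
  using (_≡_; _≢_; refl; sym; trans; cong; cong₂; subst; subst₂; module ≡-Reasoning)
open import Relation.Nullary using (¬_; Dec; does; yes; no; ¬?)
open import Relation.Nullary.Decidable
  using (True; toWitness; decidable-stable; dec-true; dec-false; _×-dec_; _⊎-dec_; _→-dec_)
open import Relation.Nullary.Negation using (contradiction)

open Sum (Ring.semiring ℚP.+-*-ring)
  using (sum; sum-cong-≗; sum-replicate-zero; ∑-distrib-+; ∑-comm; *-distribˡ-sum; *-distribʳ-sum; sum-remove)
module ℕΣ = Sum ℕP.+-*-semiring
open +-*-Solver using (solve; _:+_; _:*_; :-_; _:=_; con)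

-- Finite sums

∑ℚ≡sum : ∀ {m} (f : Fin m → ℚ) → ∑ℚ f ≡ sum f
∑ℚ≡sum {zero}  f = refl
∑ℚ≡sum {suc m} f = cong (f zero +_) (∑ℚ≡sum (f ∘ suc))

∑ℚ-cong : ∀ {m} {f g : Fin m → ℚ} → (∀ i → f i ≡ g i) → ∑ℚ f ≡ ∑ℚ g
∑ℚ-cong {f = f} {g} f≗g = trans (∑ℚ≡sum f) (trans (sum-cong-≗ {x = f} {y = g} f≗g) (sym (∑ℚ≡sum g)))

∑ℚ-zero : ∀ {m} {f : Fin m → ℚ} → (∀ i → f i ≡ 0ℚ) → ∑ℚ f ≡ 0ℚ
∑ℚ-zero {m} f≗0 = trans (∑ℚ-cong f≗0) (trans (∑ℚ≡sum {m} (λ _ → 0ℚ)) (sum-replicate-zero m))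

∑ℚ-distrib-+ : ∀ {m} (f g : Fin m → ℚ) → ∑ℚ (λ i → f i + g i) ≡ ∑ℚ f + ∑ℚ g
∑ℚ-distrib-+ f g = trans (∑ℚ≡sum (λ i → f i + g i))
  (trans (∑-distrib-+ f g) (sym (cong₂ _+_ (∑ℚ≡sum f) (∑ℚ≡sum g))))

∑ℚ-*ˡ : ∀ {m} (a : ℚ) (f : Fin m → ℚ) → a * ∑ℚ f ≡ ∑ℚ (λ i → a * f i)
∑ℚ-*ˡ a f = trans (cong (a *_) (∑ℚ≡sum f))
  (trans (*-distribˡ-sum a f) (sym (∑ℚ≡sum (λ i → a * f i))))

∑ℚ-*ʳ : ∀ {m} (a : ℚ) (f : Fin m → ℚ) → ∑ℚ f * a ≡ ∑ℚ (λ i → f i * a)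
∑ℚ-*ʳ a f = trans (cong (_* a) (∑ℚ≡sum f))
  (trans (*-distribʳ-sum a f) (sym (∑ℚ≡sum (λ i → f i * a))))

∑ℚ-comm : ∀ {m k} (f : Fin m → Fin k → ℚ) → ∑ℚ (λ i → ∑ℚ (f i)) ≡ ∑ℚ (λ j → ∑ℚ (λ i → f i j))
∑ℚ-comm f = begin
  ∑ℚ (λ i → ∑ℚ (f i))             ≡⟨ nested f ⟩
  sum (λ i → sum (f i))           ≡⟨ ∑-comm f ⟩
  sum (λ j → sum (λ i → f i j))   ≡⟨ nested (λ j i → f i j) ⟨
  ∑ℚ (λ j → ∑ℚ (λ i → f i j))     ∎
  where
  open ≡-Reasoning
  nested : ∀ {m k} (g : Fin m → Fin k → ℚ) → ∑ℚ (λ i → ∑ℚ (g i)) ≡ sum (λ i → sum (g i))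
  nested g = trans (∑ℚ-cong (λ i → ∑ℚ≡sum (g i))) (∑ℚ≡sum (λ i → sum (g i)))

∑ℚ-remove : ∀ {m} (i : Fin (suc m)) (f : Fin (suc m) → ℚ) → ∑ℚ f ≡ f i + ∑ℚ (f ∘ punchIn i)
∑ℚ-remove i f = trans (∑ℚ≡sum f) (trans (sum-remove f) (cong (f i +_) (sym (∑ℚ≡sum (f ∘ punchIn i)))))

∑ℚ-single : ∀ {m} (i : Fin m) (f : Fin m → ℚ) → (∀ j → j ≢ i → f j ≡ 0ℚ) → ∑ℚ f ≡ f i
∑ℚ-single {suc m} i f f≗0 = begin
  ∑ℚ f                          ≡⟨ ∑ℚ-remove i f ⟩
  f i + ∑ℚ (f ∘ punchIn i)      ≡⟨ cong (f i +_) (∑ℚ-zero (λ j → f≗0 _ (punchInᵢ≢i i j))) ⟩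
  f i + 0ℚ                      ≡⟨ ℚP.+-identityʳ (f i) ⟩
  f i                           ∎
  where open ≡-Reasoning

∑ℚ-indicator : ∀ {m} (a : Fin m) (f : Fin m → ℚ) → ∑ℚ (λ j → if does (j Fin.≟ a) then f j else 0ℚ) ≡ f a
∑ℚ-indicator a f = trans (∑ℚ-single a _ off) (cong (if_then f a else 0ℚ) (dec-true (a Fin.≟ a) refl))
  where
  off : ∀ j → j ≢ a → (if does (j Fin.≟ a) then f j else 0ℚ) ≡ 0ℚ
  off j j≢a = cong (if_then f j else 0ℚ) (dec-false (j Fin.≟ a) j≢a)

∑ℕ≡sum : ∀ {m} (f : Fin m → ℕ) → ∑ℕ f ≡ ℕΣ.sum f
∑ℕ≡sum {zero}  f = refl
∑ℕ≡sum {suc m} f = cong (f zero ℕ.+_) (∑ℕ≡sum (f ∘ suc))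

∑ℕ-cong : ∀ {m} {f g : Fin m → ℕ} → (∀ i → f i ≡ g i) → ∑ℕ f ≡ ∑ℕ g
∑ℕ-cong {f = f} {g} f≗g = trans (∑ℕ≡sum f) (trans (ℕΣ.sum-cong-≗ {x = f} {y = g} f≗g) (sym (∑ℕ≡sum g)))

∑ℕ-zero : ∀ m → ∑ℕ {m} (λ _ → 0) ≡ 0
∑ℕ-zero m = trans (∑ℕ≡sum {m} (λ _ → 0)) (ℕΣ.sum-replicate-zero m)

∑ℕ-distrib-+ : ∀ {m} (f g : Fin m → ℕ) → ∑ℕ (λ i → f i ℕ.+ g i) ≡ ∑ℕ f ℕ.+ ∑ℕ g
∑ℕ-distrib-+ f g = trans (∑ℕ≡sum (λ i → f i ℕ.+ g i))
  (trans (ℕΣ.∑-distrib-+ f g) (sym (cong₂ ℕ._+_ (∑ℕ≡sum f) (∑ℕ≡sum g))))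

∑ℕ-comm : ∀ {m k} (f : Fin m → Fin k → ℕ) → ∑ℕ (λ i → ∑ℕ (f i)) ≡ ∑ℕ (λ j → ∑ℕ (λ i → f i j))
∑ℕ-comm f = trans (nested f) (trans (ℕΣ.∑-comm f) (sym (nested (λ j i → f i j))))
  where
  nested : ∀ {m k} (g : Fin m → Fin k → ℕ) → ∑ℕ (λ i → ∑ℕ (g i)) ≡ ℕΣ.sum (λ i → ℕΣ.sum (g i))
  nested g = trans (∑ℕ-cong (λ i → ∑ℕ≡sum (g i))) (∑ℕ≡sum (λ i → ℕΣ.sum (g i)))

∑ℕ-mono : ∀ {m} {f g : Fin m → ℕ} → (∀ i → f i ≤ g i) → ∑ℕ f ≤ ∑ℕ g
∑ℕ-mono {zero}  f≤g = z≤n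
∑ℕ-mono {suc m} f≤g = ℕP.+-mono-≤ (f≤g zero) (∑ℕ-mono (f≤g ∘ suc))

∑ℕ-indicator : ∀ {m} (a : Fin m) → ∑ℕ (λ j → if does (j Fin.≟ a) then 1 else 0) ≡ 1
∑ℕ-indicator {suc m} zero    = cong suc (∑ℕ-zero m)
∑ℕ-indicator {suc m} (suc a) = ∑ℕ-indicator a

∑ℕ-lookup : ∀ {m} (P : Subset m) (x y : ℕ) →
  ∑ℕ (λ i → if lookup P i then x else y) ≡ ∣ P ∣ ℕ.* x ℕ.+ ∣ ∁ P ∣ ℕ.* y
∑ℕ-lookup []            x y = refl
∑ℕ-lookup (inside ∷ P)  x y =
  trans (cong (x ℕ.+_) (∑ℕ-lookup P x y)) (sym (ℕP.+-assoc x (∣ P ∣ ℕ.* x) (∣ ∁ P ∣ ℕ.* y)))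
∑ℕ-lookup (outside ∷ P) x y =
  trans (cong (y ℕ.+_) (∑ℕ-lookup P x y)) (x∙yz≈y∙xz ℕP.+-commutativeSemigroup y (∣ P ∣ ℕ.* x) (∣ ∁ P ∣ ℕ.* y))

-- Independence on a support

p≢0∧p*q≡0⇒q≡0 : ∀ {p q : ℚ} → p ≢ 0ℚ → p * q ≡ 0ℚ → q ≡ 0ℚ
p≢0∧p*q≡0⇒q≡0 {p} {q} p≢0 pq≡0 = begin
  q               ≡⟨ ℚP.*-identityˡ q ⟨
  1ℚ * q          ≡⟨ cong (_* q) (ℚP.*-inverseˡ p) ⟨
  1/p * p * q     ≡⟨ ℚP.*-assoc 1/p p q ⟩
  1/p * (p * q)   ≡⟨ cong (1/p *_) pq≡0 ⟩
  1/p * 0ℚ        ≡⟨ ℚP.*-zeroʳ 1/p ⟩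
  0ℚ              ∎
  where
  open ≡-Reasoning
  instance
    p-nonZero : ℚ.NonZero p
    p-nonZero = ℚ.≢-nonZero p≢0
  1/p : ℚ
  1/p = ℚ.1/ p

combination : ∀ {n k} → (Fin k → ℚ) → (Fin k → Vecℚ n) → Vecℚ n
combination c v j = ∑ℚ (λ i → c i * v i j)

IndependentOn : ∀ {n k} → Subset n → (Fin k → Vecℚ n) → Set
IndependentOn T v = ∀ c → (∀ j → j ∈ T → combination c v j ≡ 0ℚ) → ∀ i → c i ≡ 0ℚ

module _ {n k} {T : Subset n} {v : Fin k → Vecℚ (suc n)} where

  independentOn-outside : IndependentOn (outside ∷ T) v → IndependentOn T (tail ∘ v)
  independentOn-outside indep c vanish = indep c λ { (suc j) (there j∈T) → vanish j j∈T }

  independentOn-zeroColumn : (∀ i → v i zero ≡ 0ℚ) →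
    IndependentOn (inside ∷ T) v → IndependentOn T (tail ∘ v)
  independentOn-zeroColumn v₀≡0 indep c vanish = indep c λ
    { zero    _           → ∑ℚ-zero (λ i → trans (cong (c i *_) (v₀≡0 i)) (ℚP.*-zeroʳ (c i)))
    ; (suc j) (there j∈T) → vanish j j∈T }

module _ {n k} (v : Fin (suc k) → Vecℚ (suc n)) (i₀ : Fin (suc k)) where

  private
    p : ℚ
    p = v i₀ zero

    a : Fin k → ℚ
    a l = v (punchIn i₀ l) zero

  eliminate : Fin k → Vecℚ n
  eliminate l j = p * v (punchIn i₀ l) (suc j) ℚ.- a l * v i₀ (suc j)

  independentOn-eliminate : ∀ {T : Subset n} → p ≢ 0ℚ →
    IndependentOn (inside ∷ T) v → IndependentOn T eliminate
  independentOn-eliminate {T} p≢0 indep c vanish l = p≢0∧p*q≡0⇒q≡0 p≢0 (begin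
    p * c l                ≡⟨ insertAt-punchIn pc i₀ (- S) l ⟨
    c′ (punchIn i₀ l)      ≡⟨ indep c′ vanish′ (punchIn i₀ l) ⟩
    0ℚ                     ∎)
    where
    open ≡-Reasoning
    pc : Fin k → ℚ
    pc l = p * c l
    S : ℚ
    S = ∑ℚ (λ l → c l * a l)
    -- The combination c of the eliminated vectors, rewritten as a combination of v; it vanishes at 0.
    c′ : Fin (suc k) → ℚ
    c′ = insertAt pc i₀ (- S)

    expand : ∀ j → combination c′ v j ≡ - S * v i₀ j + ∑ℚ (λ l → pc l * v (punchIn i₀ l) j)
    expand j = trans (∑ℚ-remove i₀ (λ i → c′ i * v i j))
      (cong₂ _+_ (cong (_* v i₀ j) (insertAt-lookup pc i₀ (- S)))
                 (∑ℚ-cong (λ l → cong (_* v (punchIn i₀ l) j) (insertAt-punchIn pc i₀ (- S) l))))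

    vanish′ : ∀ j → j ∈ inside ∷ T → combination c′ v j ≡ 0ℚ
    vanish′ zero _ = begin
      combination c′ v zero                 ≡⟨ expand zero ⟩
      - S * p + ∑ℚ (λ l → pc l * a l)       ≡⟨ cong (- S * p +_) (∑ℚ-cong (λ l → ℚP.*-assoc p (c l) (a l))) ⟩
      - S * p + ∑ℚ (λ l → p * (c l * a l))  ≡⟨ cong (- S * p +_) (∑ℚ-*ˡ p (λ l → c l * a l)) ⟨
      - S * p + p * S                       ≡⟨ solve 2 (λ S p → :- S :* p :+ p :* S := con 0ℚ) refl S p ⟩
      0ℚ                                    ∎
    vanish′ (suc j) (there j∈T) = begin
      combination c′ v (suc j)                  ≡⟨ expand (suc j) ⟩
      - S * V + X                               ≡⟨ solve 3 (λ S V X → :- S :* V :+ X := X :+ S :* (:- V)) refl S V X ⟩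
      X + S * (- V)                             ≡⟨ cong (X +_) (∑ℚ-*ʳ (- V) (λ l → c l * a l)) ⟩
      X + ∑ℚ (λ l → c l * a l * (- V))          ≡⟨ ∑ℚ-distrib-+ (λ l → pc l * W l) (λ l → c l * a l * (- V)) ⟨
      ∑ℚ (λ l → pc l * W l + c l * a l * (- V)) ≡⟨ ∑ℚ-cong (λ l → regroup (c l) (W l) (a l)) ⟩
      combination c eliminate j                 ≡⟨ vanish j j∈T ⟩
      0ℚ                                        ∎
      where
      V : ℚ
      V = v i₀ (suc j)
      W : Fin k → ℚ
      W l = v (punchIn i₀ l) (suc j)
      X : ℚ
      X = ∑ℚ (λ l → pc l * W l)
      regroup : ∀ cₗ w aₗ → p * cₗ * w + cₗ * aₗ * (- V) ≡ cₗ * (p * w ℚ.- aₗ * V)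
      regroup = solve 5 (λ p V cₗ w aₗ → p :* cₗ :* w :+ cₗ :* aₗ :* (:- V) := cₗ :* (p :* w :+ :- (aₗ :* V))) refl p V

independentOn⇒≤∣T∣ : ∀ {n k} (T : Subset n) (v : Fin k → Vecℚ n) → IndependentOn T v → k ≤ ∣ T ∣
independentOn⇒≤∣T∣ {k = zero}  T v indep = z≤n
independentOn⇒≤∣T∣ {k = suc k} [] v indep = contradiction (indep (λ _ → 1ℚ) (λ ()) zero) λ ()
independentOn⇒≤∣T∣ (outside ∷ T) v indep =
  independentOn⇒≤∣T∣ T (tail ∘ v) (independentOn-outside {v = v} indep)
independentOn⇒≤∣T∣ {k = suc k} (inside ∷ T) v indep with any? (λ i → ¬? (v i zero ℚP.≟ 0ℚ))
... | yes (i₀ , p≢0) = s≤s (independentOn⇒≤∣T∣ T (eliminate v i₀) (independentOn-eliminate v i₀ p≢0 indep))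
... | no noPivot     = ℕP.m≤n⇒m≤1+n (independentOn⇒≤∣T∣ T (tail ∘ v) (independentOn-zeroColumn {v = v} zeroColumn indep))
  where
  zeroColumn : ∀ i → v i zero ≡ 0ℚ
  zeroColumn i = decidable-stable (v i zero ℚP.≟ 0ℚ) (λ v₀≢0 → noPivot (i , v₀≢0))

-- Kernels and nullity certificates

Determines : ∀ {n} → (Fin n → Fin n → ℤ) → Subset n → Set
Determines {n} M T = ∀ (x : Vecℚ n) → InKernel M x → (∀ j → j ∈ T → x j ≡ 0ℚ) → ∀ j → x j ≡ 0ℚ

combination-inKernel : ∀ {n k} (M : Fin n → Fin n → ℤ) (c : Fin k → ℚ) {v : Fin k → Vecℚ n} →
  (∀ i → InKernel M (v i)) → InKernel M (combination c v)
combination-inKernel {n} M c {v} v∈ker r = begin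
  ∑ℚ (λ j → m j * ∑ℚ (λ i → c i * v i j))     ≡⟨ ∑ℚ-cong (λ j → ∑ℚ-*ˡ (m j) (λ i → c i * v i j)) ⟩
  ∑ℚ (λ j → ∑ℚ (λ i → m j * (c i * v i j)))   ≡⟨ ∑ℚ-comm (λ j i → m j * (c i * v i j)) ⟩
  ∑ℚ (λ i → ∑ℚ (λ j → m j * (c i * v i j)))   ≡⟨ ∑ℚ-cong (λ i → ∑ℚ-cong (λ j → swap (m j) (c i) (v i j))) ⟩
  ∑ℚ (λ i → ∑ℚ (λ j → c i * (m j * v i j)))   ≡⟨ ∑ℚ-cong (λ i → ∑ℚ-*ˡ (c i) (λ j → m j * v i j)) ⟨
  ∑ℚ (λ i → c i * mulVec M (v i) r)            ≡⟨ ∑ℚ-zero (λ i → trans (cong (c i *_) (v∈ker i r)) (ℚP.*-zeroʳ (c i))) ⟩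
  0ℚ                                           ∎
  where
  open ≡-Reasoning
  m : Fin n → ℚ
  m j = M r j ℚ./ 1
  swap : ∀ x y z → x * (y * z) ≡ y * (x * z)
  swap = solve 3 (λ x y z → x :* (y :* z) := y :* (x :* z)) refl

kernel-bound : ∀ {n k} {M : Fin n → Fin n → ℤ} {T : Subset n} → Determines M T →
  (v : Fin k → Vecℚ n) → LinIndep v → (∀ i → InKernel M (v i)) → k ≤ ∣ T ∣
kernel-bound {M = M} {T} determines v indep v∈ker = independentOn⇒≤∣T∣ T v λ c vanish →
  indep c (determines (combination c v) (combination-inKernel M c v∈ker) vanish)

record NullityCertificate {n : ℕ} (M : Fin n → Fin n → ℤ) (k : ℕ) : Set where
  field
    basis       : Fin k → Vecℚ n
    independent : LinIndep basis
    inKernel    : ∀ i → InKernel M (basis i)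
    support     : Subset n
    ∣support∣≤k : ∣ support ∣ ≤ k
    determines  : Determines M support

certificate⇒kernelDim : ∀ {n k} {M : Fin n → Fin n → ℤ} → NullityCertificate M k → KernelDim M k
certificate⇒kernelDim {M = M} C = (basis , independent , inKernel) , λ w w∈ker indep →
  ℕP.<-irrefl refl (ℕP.≤-trans (kernel-bound {M = M} determines w indep w∈ker) ∣support∣≤k)
  where open NullityCertificate C

determines⊥⇒certificate : ∀ {n} {M : Fin n → Fin n → ℤ} → Determines M ⊥ → NullityCertificate M 0
determines⊥⇒certificate {n} determines = record
  { basis       = λ ()
  ; independent = λ _ _ ()
  ; inKernel    = λ ()
  ; support     = ⊥
  ; ∣support∣≤k = ℕP.≤-reflexive (∣⊥∣≡0 n)
  ; determines  = determines
  }

δ : ∀ {n} → Fin n → Fin n → ℚ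
δ i j = if does (i Fin.≟ j) then 1ℚ else 0ℚ

IsLeftInverse : ∀ {n} → (Fin n → Fin n → ℚ) → (Fin n → Fin n → ℤ) → Set
IsLeftInverse C M = ∀ i j → ∑ℚ (λ r → C i r * (M r j ℚ./ 1)) ≡ δ i j

isLeftInverse? : ∀ {n} (C : Fin n → Fin n → ℚ) (M : Fin n → Fin n → ℤ) → Dec (IsLeftInverse C M)
isLeftInverse? C M = all? (λ i → all? (λ j → ∑ℚ (λ r → C i r * (M r j ℚ./ 1)) ℚP.≟ δ i j))

leftInverse⇒determines : ∀ {n} (C : Fin n → Fin n → ℚ) (M : Fin n → Fin n → ℤ) →
  IsLeftInverse C M → Determines M ⊥
leftInverse⇒determines {n} C M CM≡I x x∈ker _ i = begin
  x i                                           ≡⟨ diagonal ⟨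
  δ i i * x i                                   ≡⟨ ∑ℚ-single i (λ j → δ i j * x j) off-diagonal ⟨
  ∑ℚ (λ j → δ i j * x j)                        ≡⟨ ∑ℚ-cong (λ j → cong (_* x j) (CM≡I i j)) ⟨
  ∑ℚ (λ j → ∑ℚ (λ r → C i r * m r j) * x j)     ≡⟨ ∑ℚ-cong (λ j → ∑ℚ-*ʳ (x j) (λ r → C i r * m r j)) ⟩
  ∑ℚ (λ j → ∑ℚ (λ r → C i r * m r j * x j))     ≡⟨ ∑ℚ-comm (λ j r → C i r * m r j * x j) ⟩
  ∑ℚ (λ r → ∑ℚ (λ j → C i r * m r j * x j))     ≡⟨ ∑ℚ-cong (λ r → ∑ℚ-cong (λ j → ℚP.*-assoc (C i r) (m r j) (x j))) ⟩
  ∑ℚ (λ r → ∑ℚ (λ j → C i r * (m r j * x j)))   ≡⟨ ∑ℚ-cong (λ r → ∑ℚ-*ˡ (C i r) (λ j → m r j * x j)) ⟨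
  ∑ℚ (λ r → C i r * mulVec M x r)               ≡⟨ ∑ℚ-zero (λ r → trans (cong (C i r *_) (x∈ker r)) (ℚP.*-zeroʳ (C i r))) ⟩
  0ℚ                                            ∎
  where
  open ≡-Reasoning
  m : Fin n → Fin n → ℚ
  m r j = M r j ℚ./ 1
  diagonal : δ i i * x i ≡ x i
  diagonal = trans (cong (λ b → (if b then 1ℚ else 0ℚ) * x i) (dec-true (i Fin.≟ i) refl))
    (ℚP.*-identityˡ (x i))
  off-diagonal : ∀ j → j ≢ i → δ i j * x j ≡ 0ℚ
  off-diagonal j j≢i = trans (cong (λ b → (if b then 1ℚ else 0ℚ) * x j) (dec-false (i Fin.≟ j) (j≢i ∘ sym)))
    (ℚP.*-zeroˡ (x j))

-- Pivot rows of signed adjacency matrices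

module _ {n} (G : Graph n) where

  adj-sym : ∀ {x y b} → adj G x y ≡ b → adj G y x ≡ b
  adj-sym {x} {y} xy = trans (Graph.sym G y x) xy

  adjacent⇒≢ : ∀ {x y} → adj G x y ≡ true → x ≢ y
  adjacent⇒≢ {x} xy refl = not-¬ xy (irrefl G x)

signℚ-cancel : ∀ s {q} → (signℤ s ℚ./ 1) * q ≡ 0ℚ → q ≡ 0ℚ
signℚ-cancel s = p≢0∧p*q≡0⇒q≡0 (sign≢0 s)
  where
  sign≢0 : ∀ s → signℤ s ℚ./ 1 ≢ 0ℚ
  sign≢0 plus  ()
  sign≢0 minus ()

module _ {n} (Γ : SignedGraph n) where

  private
    G : Graph n
    G = graph Γ
    A : Fin n → Fin n → ℤ
    A = adjMatrix Γ

  entry-adjacent : ∀ {r c} → adj G r c ≡ true → A r c ≡ signℤ (σ Γ r c)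
  entry-adjacent {r} {c} = cong (if_then signℤ (σ Γ r c) else 0ℤ)

  entry-nonAdjacent : ∀ {r c} → adj G r c ≡ false → A r c ≡ 0ℤ
  entry-nonAdjacent {r} {c} = cong (if_then signℤ (σ Γ r c) else 0ℤ)

  kernel-pivot : ∀ {x r c} → InKernel A x → adj G r c ≡ true →
    (∀ j → j ≢ c → adj G r j ≡ false ⊎ x j ≡ 0ℚ) → x c ≡ 0ℚ
  kernel-pivot {x} {r} {c} x∈ker r~c others = signℚ-cancel (σ Γ r c) (begin
    (signℤ (σ Γ r c) ℚ./ 1) * x c    ≡⟨ cong (λ e → (e ℚ./ 1) * x c) (entry-adjacent r~c) ⟨
    (A r c ℚ./ 1) * x c             ≡⟨ ∑ℚ-single c (λ j → (A r j ℚ./ 1) * x j) vanish ⟨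
    mulVec A x r                    ≡⟨ x∈ker r ⟩
    0ℚ                              ∎)
    where
    open ≡-Reasoning
    vanish : ∀ j → j ≢ c → (A r j ℚ./ 1) * x j ≡ 0ℚ
    vanish j j≢c with others j j≢c
    ... | inj₁ r≁j  = trans (cong (λ e → (e ℚ./ 1) * x j) (entry-nonAdjacent r≁j)) (ℚP.*-zeroˡ (x j))
    ... | inj₂ xj≡0 = trans (cong ((A r j ℚ./ 1) *_) xj≡0) (ℚP.*-zeroʳ (A r j ℚ./ 1))

  data Forced (T : Subset n) : Fin n → Set where
    assumed : ∀ {c} → c ∈ T → Forced T c
    pivot   : ∀ {c} r → adj G r c ≡ true → (∀ j → j ≢ c → adj G r j ≡ false ⊎ Forced T j) → Forced T c

  forced⇒zero : ∀ {T x} → InKernel A x → (∀ j → j ∈ T → x j ≡ 0ℚ) → ∀ {c} → Forced T c → x c ≡ 0ℚ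
  forced⇒zero x∈ker x|T≡0 (assumed c∈T) = x|T≡0 _ c∈T
  forced⇒zero {T} {x} x∈ker x|T≡0 (pivot r r~c others) =
    kernel-pivot x∈ker r~c λ j j≢c → recurse (others j j≢c)
    where
    recurse : ∀ {j} → adj G r j ≡ false ⊎ Forced T j → adj G r j ≡ false ⊎ x j ≡ 0ℚ
    recurse (inj₁ r≁j)    = inj₁ r≁j
    recurse (inj₂ forced) = inj₂ (forced⇒zero x∈ker x|T≡0 forced)

  forced⇒determines : ∀ {T} → (∀ c → Forced T c) → Determines A T
  forced⇒determines forced x x∈ker x|T≡0 c = forced⇒zero x∈ker x|T≡0 (forced c)

  PivotSequence : Subset n → List (Fin n × Fin n) → Set
  PivotSequence K []             = ∀ j → j ∈ K
  PivotSequence K ((r , c) ∷ ps) =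
    adj G r c ≡ true × (∀ j → j ≢ c → adj G r j ≡ false ⊎ j ∈ K) × PivotSequence (K ∪ ⁅ c ⁆) ps

  pivotSequence? : ∀ K ps → Dec (PivotSequence K ps)
  pivotSequence? K []             = all? (_∈? K)
  pivotSequence? K ((r , c) ∷ ps) =
    adj G r c Bool.≟ true
    ×-dec all? (λ j → ¬? (j Fin.≟ c) →-dec (adj G r j Bool.≟ false ⊎-dec j ∈? K))
    ×-dec pivotSequence? (K ∪ ⁅ c ⁆) ps

  pivotSequence⇒forced : ∀ {T} K ps → (∀ {j} → j ∈ K → Forced T j) → PivotSequence K ps → ∀ c → Forced T c
  pivotSequence⇒forced K []                 known everything c = known (everything c)
  pivotSequence⇒forced {T} K ((r , c) ∷ ps) known (r~c , others , rest) =
    pivotSequence⇒forced (K ∪ ⁅ c ⁆) ps known′ rest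
    where
    forced-c : Forced T c
    forced-c = pivot r r~c (λ j j≢c → map₂ known (others j j≢c))
    known′ : ∀ {j} → j ∈ K ∪ ⁅ c ⁆ → Forced T j
    known′ j∈K∪c with x∈p∪q⁻ K ⁅ c ⁆ j∈K∪c
    ... | inj₁ j∈K = known j∈K
    ... | inj₂ j∈c = subst (Forced T) (sym (x∈⁅y⁆⇒x≡y c j∈c)) forced-c

  pivots⇒determines : ∀ T ps → True (pivotSequence? T ps) → Determines A T
  pivots⇒determines T ps valid = forced⇒determines (pivotSequence⇒forced T ps assumed (toWitness valid))

-- Counting edges

<ᵇ-true : ∀ {m n} → m ℕ.< n → (m ℕ.<ᵇ n) ≡ true
<ᵇ-true m<n = T-≡ .Equivalence.to (ℕP.<⇒<ᵇ m<n)

<ᵇ-false : ∀ {m n} → ¬ m ℕ.< n → (m ℕ.<ᵇ n) ≡ false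
<ᵇ-false {m} {n} m≮n = ¬-not (m≮n ∘ ℕP.<ᵇ⇒< m n ∘ T-≡ .Equivalence.from)

+-double-cancel-≤ : ∀ {x y} → x ℕ.+ x ≤ y ℕ.+ y → x ≤ y
+-double-cancel-≤ x+x≤y+y = ℕP.≮⇒≥ λ y<x → ℕP.<⇒≱ (ℕP.+-mono-< y<x y<x) x+x≤y+y

cross : Bool → Bool → ℕ
cross b c = if b then (if c then 0 else 1) else (if c then 1 else 0)

∑ℕ-cross : ∀ {n} (P : Subset n) →
  ∑ℕ (λ x → ∑ℕ (λ y → cross (lookup P x) (lookup P y))) ≡ ∣ P ∣ ℕ.* ∣ ∁ P ∣ ℕ.+ ∣ ∁ P ∣ ℕ.* ∣ P ∣
∑ℕ-cross P = trans (∑ℕ-cong (λ x → row (lookup P x))) (∑ℕ-lookup P ∣ ∁ P ∣ ∣ P ∣)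
  where
  row : ∀ b → ∑ℕ (λ y → cross b (lookup P y)) ≡ (if b then ∣ ∁ P ∣ else ∣ P ∣)
  row true  = trans (∑ℕ-lookup P 0 1) (cong₂ ℕ._+_ (ℕP.*-zeroʳ ∣ P ∣) (ℕP.*-identityʳ ∣ ∁ P ∣))
  row false = trans (∑ℕ-lookup P 1 0)
    (trans (cong₂ ℕ._+_ (ℕP.*-identityʳ ∣ P ∣) (ℕP.*-zeroʳ ∣ ∁ P ∣)) (ℕP.+-identityʳ ∣ P ∣))

2≤∣p∣ : ∀ {n} (p : Subset n) {x y} → lookup p x ≡ true → lookup p y ≡ true → x ≢ y → 2 ≤ ∣ p ∣
2≤∣p∣ p {x} {y} px py x≢y =
  ℕP.≤-trans (s≤s (s≤s z≤n)) (ℕP.≤-trans (s≤s (x∈p⇒∣p-x∣<∣p∣ y∈p-x)) (x∈p⇒∣p-x∣<∣p∣ x∈p))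
  where
  x∈p : x ∈ p
  x∈p = lookup⇒[]= x p px
  y∈p-x : y ∈ p - x
  y∈p-x = x∈p∧x≢y⇒x∈p-y (lookup⇒[]= y p py) (x≢y ∘ sym)

lookup-∁ : ∀ {n} (p : Subset n) x → lookup p x ≡ false → lookup (∁ p) x ≡ true
lookup-∁ p x px = trans (lookup-map x not p) (cong not px)

∣p∣+∣∁p∣≡n : ∀ {n} (p : Subset n) → ∣ p ∣ ℕ.+ ∣ ∁ p ∣ ≡ n
∣p∣+∣∁p∣≡n p = trans (cong (∣ p ∣ ℕ.+_) (∣∁p∣≡n∸∣p∣ p)) (ℕP.m+[n∸m]≡n (∣p∣≤n p))

m+n+1<m*n : ∀ {m n} → 2 ≤ m → 2 ≤ n → 6 ≤ m ℕ.+ n → m ℕ.+ n ℕ.+ 1 ℕ.< m ℕ.* n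
m+n+1<m*n {suc (suc m)} {suc (suc n)} (s≤s (s≤s _)) (s≤s (s≤s _)) 6≤m+n = begin
  suc (suc (suc m) ℕ.+ suc (suc n) ℕ.+ 1) ≡⟨ lhs m n ⟩
  4 ℕ.+ (2 ℕ.+ u)                         ≤⟨ ℕP.+-monoʳ-≤ 4 (ℕP.+-monoˡ-≤ u 2≤u) ⟩
  4 ℕ.+ (u ℕ.+ u)                         ≤⟨ ℕP.m≤m+n (4 ℕ.+ (u ℕ.+ u)) (m ℕ.* n) ⟩
  4 ℕ.+ (u ℕ.+ u) ℕ.+ m ℕ.* n             ≡⟨ rhs m n ⟩
  suc (suc m) ℕ.* suc (suc n)             ∎
  where
  open ℕP.≤-Reasoning
  u : ℕ
  u = m ℕ.+ n
  lhs : ∀ m n → suc (suc (suc m) ℕ.+ suc (suc n) ℕ.+ 1) ≡ 4 ℕ.+ (2 ℕ.+ (m ℕ.+ n))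
  lhs = solve-∀
  rhs : ∀ m n → 4 ℕ.+ ((m ℕ.+ n) ℕ.+ (m ℕ.+ n)) ℕ.+ m ℕ.* n ≡ suc (suc m) ℕ.* suc (suc n)
  rhs = solve-∀
  total : ∀ m n → suc (suc m) ℕ.+ suc (suc n) ≡ 4 ℕ.+ (m ℕ.+ n)
  total = solve-∀
  2≤u : 2 ≤ u
  2≤u = ℕP.+-cancelˡ-≤ 4 2 u (subst (6 ≤_) (total m n) 6≤m+n)

m*n<m+n+1 : ∀ {m n} → m ≤ 1 → m ℕ.* n ℕ.< m ℕ.+ n ℕ.+ 1
m*n<m+n+1 {m} {n} m≤1 = ℕP.≤-<-trans (begin
  m ℕ.* n         ≤⟨ ℕP.*-monoˡ-≤ n m≤1 ⟩
  1 ℕ.* n         ≡⟨ ℕP.*-identityˡ n ⟩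
  n               ≤⟨ ℕP.m≤n+m n m ⟩
  m ℕ.+ n         ∎) (ℕP.m<m+n (m ℕ.+ n) ℕ.z<s)
  where open ℕP.≤-Reasoning

module _ {n} (G : Graph n) where

  private
    a : Fin n → Fin n → ℕ
    a i j = if adj G i j then 1 else 0

  handshake : ∑ℕ (λ i → ∑ℕ (a i)) ≡ edgeCount G ℕ.+ edgeCount G
  handshake = begin
    ∑ℕ (λ i → ∑ℕ (a i))                             ≡⟨ ∑ℕ-cong (λ i → ∑ℕ-cong (split i)) ⟩
    ∑ℕ (λ i → ∑ℕ (λ j → upper i j ℕ.+ lower i j))   ≡⟨ ∑ℕ-cong (λ i → ∑ℕ-distrib-+ (upper i) (lower i)) ⟩
    ∑ℕ (λ i → ∑ℕ (upper i) ℕ.+ ∑ℕ (lower i))        ≡⟨ ∑ℕ-distrib-+ (λ i → ∑ℕ (upper i)) (λ i → ∑ℕ (lower i)) ⟩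
    edgeCount G ℕ.+ ∑ℕ (λ i → ∑ℕ (lower i))         ≡⟨ cong (edgeCount G ℕ.+_) (∑ℕ-comm lower) ⟩
    edgeCount G ℕ.+ ∑ℕ (λ j → ∑ℕ (λ i → lower i j)) ≡⟨ cong (edgeCount G ℕ.+_) (∑ℕ-cong (λ j → ∑ℕ-cong (lower≡upperᵀ j))) ⟩
    edgeCount G ℕ.+ edgeCount G                     ∎
    where
    open ≡-Reasoning
    upper lower : Fin n → Fin n → ℕ
    upper i j = if toℕ i ℕ.<ᵇ toℕ j then a i j else 0
    lower i j = if toℕ j ℕ.<ᵇ toℕ i then a i j else 0
    split : ∀ i j → a i j ≡ upper i j ℕ.+ lower i j
    split i j with ℕP.<-cmp (toℕ i) (toℕ j)
    ... | tri< i<j _ j≮i rewrite <ᵇ-true i<j | <ᵇ-false j≮i = sym (ℕP.+-identityʳ (a i j))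
    ... | tri> i≮j _ j<i rewrite <ᵇ-false i≮j | <ᵇ-true j<i = refl
    ... | tri≈ i≮j i≡j j≮i rewrite <ᵇ-false i≮j | <ᵇ-false j≮i | toℕ-injective i≡j =
      cong (if_then 1 else 0) (irrefl G j)
    lower≡upperᵀ : ∀ j i → lower i j ≡ upper j i
    lower≡upperᵀ j i = cong (λ b → if toℕ j ℕ.<ᵇ toℕ i then (if b then 1 else 0) else 0) (Graph.sym G i j)

  module _ (P : Subset n) where

    private
      s t : ℕ
      s = ∣ P ∣
      t = ∣ ∁ P ∣

    CompleteAcross : Set
    CompleteAcross = ∀ x y → lookup P x ≡ true → lookup P y ≡ false → adj G x y ≡ true

    EdgesAcross : Set
    EdgesAcross = ∀ x y → adj G x y ≡ true → lookup P x ≢ lookup P y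

    completeAcross⇒∣P∣*∣∁P∣≤edgeCount : CompleteAcross → s ℕ.* t ≤ edgeCount G
    completeAcross⇒∣P∣*∣∁P∣≤edgeCount complete = +-double-cancel-≤ (begin
      s ℕ.* t ℕ.+ s ℕ.* t                                   ≡⟨ cong (s ℕ.* t ℕ.+_) (ℕP.*-comm s t) ⟩
      s ℕ.* t ℕ.+ t ℕ.* s                                   ≡⟨ ∑ℕ-cross P ⟨
      ∑ℕ (λ x → ∑ℕ (λ y → cross (lookup P x) (lookup P y))) ≤⟨ ∑ℕ-mono (λ x → ∑ℕ-mono (cross≤adj x)) ⟩
      ∑ℕ (λ x → ∑ℕ (a x))                                   ≡⟨ handshake ⟩
      edgeCount G ℕ.+ edgeCount G                           ∎)
      where
      open ℕP.≤-Reasoning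
      cross≤adj : ∀ x y → cross (lookup P x) (lookup P y) ≤ a x y
      cross≤adj x y with lookup P x in px | lookup P y in py
      ... | true  | true  = z≤n
      ... | false | false = z≤n
      ... | true  | false rewrite complete x y px py = ℕP.≤-refl
      ... | false | true  rewrite adj-sym G (complete y x py px) = ℕP.≤-refl

    edgesAcross⇒edgeCount≤∣P∣*∣∁P∣ : EdgesAcross → edgeCount G ≤ s ℕ.* t
    edgesAcross⇒edgeCount≤∣P∣*∣∁P∣ across = +-double-cancel-≤ (begin
      edgeCount G ℕ.+ edgeCount G                           ≡⟨ handshake ⟨
      ∑ℕ (λ x → ∑ℕ (a x))                                   ≤⟨ ∑ℕ-mono (λ x → ∑ℕ-mono (adj≤cross x)) ⟩
      ∑ℕ (λ x → ∑ℕ (λ y → cross (lookup P x) (lookup P y))) ≡⟨ ∑ℕ-cross P ⟩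
      s ℕ.* t ℕ.+ t ℕ.* s                                   ≡⟨ cong (s ℕ.* t ℕ.+_) (ℕP.*-comm t s) ⟩
      s ℕ.* t ℕ.+ s ℕ.* t                                   ∎)
      where
      open ℕP.≤-Reasoning
      adj≤cross : ∀ x y → a x y ≤ cross (lookup P x) (lookup P y)
      adj≤cross x y with adj G x y in x~y
      ... | false = z≤n
      ... | true with lookup P x in px | lookup P y in py
      ...   | true  | false = ℕP.≤-refl
      ...   | false | true  = ℕP.≤-refl
      ...   | true  | true  = contradiction (trans px (sym py)) (across x y x~y)
      ...   | false | false = contradiction (trans px (sym py)) (across x y x~y)

    completeAcross⇒edgeCount≢ : CompleteAcross → 2 ≤ s → 2 ≤ t → 6 ≤ n → edgeCount G ≢ n ℕ.+ 1
    completeAcross⇒edgeCount≢ complete 2≤s 2≤t 6≤n edges = ℕP.<⇒≱ (m+n+1<m*n 2≤s 2≤t 6≤s+t) (begin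
      s ℕ.* t          ≤⟨ completeAcross⇒∣P∣*∣∁P∣≤edgeCount complete ⟩
      edgeCount G      ≡⟨ edges ⟩
      n ℕ.+ 1          ≡⟨ cong (ℕ._+ 1) (∣p∣+∣∁p∣≡n P) ⟨
      s ℕ.+ t ℕ.+ 1    ∎)
      where
      open ℕP.≤-Reasoning
      6≤s+t : 6 ≤ s ℕ.+ t
      6≤s+t = subst (6 ≤_) (sym (∣p∣+∣∁p∣≡n P)) 6≤n

    edgesAcross⇒edgeCount≢ : EdgesAcross → s ≤ 1 → edgeCount G ≢ n ℕ.+ 1
    edgesAcross⇒edgeCount≢ across s≤1 edges = ℕP.<⇒≱ (m*n<m+n+1 s≤1) (begin
      s ℕ.+ t ℕ.+ 1    ≡⟨ cong (ℕ._+ 1) (∣p∣+∣∁p∣≡n P) ⟩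
      n ℕ.+ 1          ≡⟨ edges ⟨
      edgeCount G      ≤⟨ edgesAcross⇒edgeCount≤∣P∣*∣∁P∣ across ⟩
      s ℕ.* t          ∎)
      where open ℕP.≤-Reasoning

complete⇒edgeCount≢ : ∀ {n} (G : Graph n) → 6 ≤ n → (∀ u w → u ≢ w → adj G u w ≡ true) →
  edgeCount G ≢ n ℕ.+ 1
complete⇒edgeCount≢ {suc (suc (suc (suc m)))} G 6≤n@(s≤s (s≤s (s≤s (s≤s _)))) complete =
  completeAcross⇒edgeCount≢ G P across
    (2≤∣p∣ P {0F} {1F} refl refl λ ()) (2≤∣p∣ (∁ P) {2F} {3F} refl refl λ ()) 6≤n
  where
  P : Subset (suc (suc (suc (suc m))))
  P = inside ∷ inside ∷ ⊥
  across : CompleteAcross G P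
  across x y Px Py = complete x y λ { refl → not-¬ Px Py }

K₁∪K₂-Free : ∀ {n} → Graph n → Set
K₁∪K₂-Free {n} G =
  ∀ (w a b : Fin n) → adj G a b ≡ true → w ≢ a → w ≢ b → adj G w a ≡ true ⊎ adj G w b ≡ true

module _ {n} (G : Graph n) (free : K₁∪K₂-Free G) (u : Fin n) where

  private
    N : Subset n
    N = tabulate (adj G u)

    N≡ : ∀ x → lookup N x ≡ adj G u x
    N≡ = lookup∘tabulate (adj G u)

  neighbourhood-completeAcross : CompleteAcross G N
  neighbourhood-completeAcross x y Nx Ny with y Fin.≟ u
  ... | yes refl = adj-sym G (trans (sym (N≡ x)) Nx)
  ... | no y≢u with free y u x (trans (sym (N≡ x)) Nx) y≢u (λ { refl → not-¬ Nx Ny })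
  ...   | inj₁ y~u = contradiction (trans (sym (N≡ y)) Ny) (not-¬ (adj-sym G y~u))
  ...   | inj₂ y~x = adj-sym G y~x

  neighbourhood-edgesAcross : ¬ 2 ≤ ∣ N ∣ → EdgesAcross G N
  neighbourhood-edgesAcross 2≰∣N∣ x y x~y Nx≡Ny with adj G u x in u~x
  ... | true  = 2≰∣N∣ (2≤∣p∣ N (trans (N≡ x) u~x) (trans (sym Nx≡Ny) (trans (N≡ x) u~x)) (adjacent⇒≢ G x~y))
  ... | false = nonNeighbours u~x (trans (sym (N≡ y)) (trans (sym Nx≡Ny) (trans (N≡ x) u~x)))
    where
    nonNeighbours : adj G u x ≡ false → adj G u y ≡ false → Empty.⊥
    nonNeighbours u≁x u≁y with x Fin.≟ u | y Fin.≟ u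
    ... | yes refl | _        = not-¬ x~y u≁y
    ... | no _     | yes refl = not-¬ (adj-sym G x~y) u≁x
    ... | no x≢u   | no y≢u   with free u x y x~y (x≢u ∘ sym) (y≢u ∘ sym)
    ...   | inj₁ u~x = not-¬ u~x u≁x
    ...   | inj₂ u~y = not-¬ u~y u≁y

  nonEdge⇒edgeCount≢ : ∀ {w} → u ≢ w → adj G u w ≡ false → 6 ≤ n → edgeCount G ≢ n ℕ.+ 1
  nonEdge⇒edgeCount≢ {w} u≢w u≁w 6≤n with 2 ℕ.≤? ∣ N ∣
  ... | yes 2≤∣N∣ = completeAcross⇒edgeCount≢ G N neighbourhood-completeAcross 2≤∣N∣ 2≤∣∁N∣ 6≤n
    where
    2≤∣∁N∣ : 2 ≤ ∣ ∁ N ∣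
    2≤∣∁N∣ = 2≤∣p∣ (∁ N) (lookup-∁ N u (trans (N≡ u) (irrefl G u))) (lookup-∁ N w (trans (N≡ w) u≁w)) u≢w
  ... | no 2≰∣N∣  = edgesAcross⇒edgeCount≢ G N (neighbourhood-edgesAcross 2≰∣N∣) (ℕP.≤-pred (ℕP.≰⇒> 2≰∣N∣))

K₁∪K₂-free⇒edgeCount≢ : ∀ {n} (G : Graph n) → 6 ≤ n → K₁∪K₂-Free G → edgeCount G ≢ n ℕ.+ 1
K₁∪K₂-free⇒edgeCount≢ G 6≤n free with any? (λ u → any? (λ w → ¬? (u Fin.≟ w) ×-dec adj G u w Bool.≟ false))
... | yes (u , w , u≢w , u≁w) = nonEdge⇒edgeCount≢ G free u u≢w u≁w 6≤n
... | no noNonEdge             = complete⇒edgeCount≢ G 6≤n complete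
  where
  complete : ∀ u w → u ≢ w → adj G u w ≡ true
  complete u w u≢w with adj G u w in u~w
  ... | true  = refl
  ... | false = contradiction (u , w , u≢w , u~w) noNonEdge

-- The upper bound

module _ {n} (Γ : SignedGraph n) {w c a b : Fin n}
         (w~c : adj (graph Γ) w c ≡ true) (a~b : adj (graph Γ) a b ≡ true)
         (w≁a : adj (graph Γ) w a ≡ false) (w≁b : adj (graph Γ) w b ≡ false)
         (w≢a : w ≢ a) (w≢b : w ≢ b) where

  private
    G : Graph n
    G = graph Γ

    c≢w : c ≢ w
    c≢w = adjacent⇒≢ G w~c ∘ sym
    c≢a : c ≢ a
    c≢a refl = not-¬ w~c w≁a
    c≢b : c ≢ b
    c≢b refl = not-¬ w~c w≁b
    a≢b : a ≢ b
    a≢b = adjacent⇒≢ G a~b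

    cases : ∀ {X : Set} j → (j ≡ w → X) → (j ≡ c → X) → (j ≡ a → X) → (j ≡ b → X) →
      (j ∈ ⊤ - w - c - a - b → X) → X
    cases j kw kc ka kb kT with j Fin.≟ w | j Fin.≟ c | j Fin.≟ a | j Fin.≟ b
    ... | yes j≡w | _       | _       | _       = kw j≡w
    ... | no _    | yes j≡c | _       | _       = kc j≡c
    ... | no _    | no _    | yes j≡a | _       = ka j≡a
    ... | no _    | no _    | no _    | yes j≡b = kb j≡b
    ... | no j≢w  | no j≢c  | no j≢a  | no j≢b  =
      kT (x∈p∧x≢y⇒x∈p-y (x∈p∧x≢y⇒x∈p-y (x∈p∧x≢y⇒x∈p-y (x∈p∧x≢y⇒x∈p-y ∈⊤ j≢w) j≢c) j≢a) j≢b)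

    forced-c : Forced Γ (⊤ - w - c - a - b) c
    forced-c = pivot w w~c λ j j≢c → cases j
      (λ { refl → inj₁ (irrefl G w) }) (λ j≡c → contradiction j≡c j≢c)
      (λ { refl → inj₁ w≁a }) (λ { refl → inj₁ w≁b }) (inj₂ ∘ assumed)

    forced-b : Forced Γ (⊤ - w - c - a - b) b
    forced-b = pivot a a~b λ j j≢b → cases j
      (λ { refl → inj₁ (adj-sym G w≁a) }) (λ { refl → inj₂ forced-c })
      (λ { refl → inj₁ (irrefl G a) }) (λ j≡b → contradiction j≡b j≢b) (inj₂ ∘ assumed)

    forced-a : Forced Γ (⊤ - w - c - a - b) a
    forced-a = pivot b (adj-sym G a~b) λ j j≢a → cases j
      (λ { refl → inj₁ (adj-sym G w≁b) }) (λ { refl → inj₂ forced-c })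
      (λ j≡a → contradiction j≡a j≢a) (λ { refl → inj₁ (irrefl G b) }) (inj₂ ∘ assumed)

    forced-w : Forced Γ (⊤ - w - c - a - b) w
    forced-w = pivot c (adj-sym G w~c) λ j j≢w → cases j
      (λ j≡w → contradiction j≡w j≢w) (λ { refl → inj₁ (irrefl G c) })
      (λ { refl → inj₂ forced-a }) (λ { refl → inj₂ forced-b }) (inj₂ ∘ assumed)

  determines-⊤-wcab : Determines (adjMatrix Γ) (⊤ - w - c - a - b)
  determines-⊤-wcab = forced⇒determines Γ λ j → cases j
    (λ { refl → forced-w }) (λ { refl → forced-c }) (λ { refl → forced-a }) (λ { refl → forced-b }) assumed

  ∣⊤-wcab∣≤n∸4 : ∣ ⊤ - w - c - a - b ∣ ≤ n ∸ 4
  ∣⊤-wcab∣≤n∸4 = ℕP.m+n≤o⇒m≤o∸n ∣ ⊤ - w - c - a - b ∣ (subst (_≤ n) (ℕP.+-comm 4 _) (begin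
    4 ℕ.+ ∣ ⊤ - w - c - a - b ∣   ≤⟨ s≤s (s≤s (s≤s (x∈p⇒∣p-x∣<∣p∣ b∈))) ⟩
    3 ℕ.+ ∣ ⊤ - w - c - a ∣       ≤⟨ s≤s (s≤s (x∈p⇒∣p-x∣<∣p∣ a∈)) ⟩
    2 ℕ.+ ∣ ⊤ - w - c ∣           ≤⟨ s≤s (x∈p⇒∣p-x∣<∣p∣ c∈) ⟩
    1 ℕ.+ ∣ ⊤ - w ∣               ≤⟨ x∈p⇒∣p-x∣<∣p∣ (∈⊤ {x = w}) ⟩
    ∣ ⊤ {n} ∣                     ≡⟨ ∣⊤∣≡n n ⟩
    n                             ∎))
    where
    open ℕP.≤-Reasoning
    c∈ : c ∈ ⊤ - w
    c∈ = x∈p∧x≢y⇒x∈p-y ∈⊤ c≢w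
    a∈ : a ∈ ⊤ - w - c
    a∈ = x∈p∧x≢y⇒x∈p-y (x∈p∧x≢y⇒x∈p-y ∈⊤ (w≢a ∘ sym)) (c≢a ∘ sym)
    b∈ : b ∈ ⊤ - w - c - a
    b∈ = x∈p∧x≢y⇒x∈p-y (x∈p∧x≢y⇒x∈p-y (x∈p∧x≢y⇒x∈p-y ∈⊤ (w≢b ∘ sym)) (c≢b ∘ sym)) (a≢b ∘ sym)

record InducedK₁∪K₂ {n} (G : Graph n) : Set where
  field
    w a b : Fin n
    a~b   : adj G a b ≡ true
    w≁a   : adj G w a ≡ false
    w≁b   : adj G w b ≡ false
    w≢a   : w ≢ a
    w≢b   : w ≢ b

inducedK₁∪K₂? : ∀ {n} (G : Graph n) → InducedK₁∪K₂ G ⊎ K₁∪K₂-Free G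
inducedK₁∪K₂? G with any? (λ w → any? (λ a → any? (λ b →
  adj G a b Bool.≟ true ×-dec adj G w a Bool.≟ false ×-dec adj G w b Bool.≟ false
  ×-dec ¬? (w Fin.≟ a) ×-dec ¬? (w Fin.≟ b))))
... | yes (w , a , b , a~b , w≁a , w≁b , w≢a , w≢b) = inj₁ record
  { w = w ; a = a ; b = b ; a~b = a~b ; w≁a = w≁a ; w≁b = w≁b ; w≢a = w≢a ; w≢b = w≢b }
... | no none = inj₂ free
  where
  free : K₁∪K₂-Free G
  free w a b a~b w≢a w≢b with adj G w a in w~a | adj G w b in w~b
  ... | true  | _     = inj₁ refl
  ... | false | true  = inj₂ refl
  ... | false | false = contradiction (w , a , b , a~b , w~a , w~b , w≢a , w≢b) none

reach⇒neighbour : ∀ {n} {G : Graph n} {w a} → Reach G w a → w ≢ a → Σ (Fin n) λ c → adj G w c ≡ true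
reach⇒neighbour here         w≢w = contradiction refl w≢w
reach⇒neighbour (step w~c _) _   = _ , T-≡ .Equivalence.to w~c

nullity≤n∸4 : ∀ {n k} (Γ : SignedGraph n) → 8 ≤ n → Bicyclic (graph Γ) → Nullity Γ k → k ≤ n ∸ 4
nullity≤n∸4 {n} Γ 8≤n (connected , edges) ((v , indep , v∈ker) , _) with inducedK₁∪K₂? (graph Γ)
... | inj₂ free = contradiction edges (K₁∪K₂-free⇒edgeCount≢ (graph Γ) (ℕP.≤-trans (ℕP.m≤m+n 6 2) 8≤n) free)
... | inj₁ H    = ℕP.≤-trans
  (kernel-bound {M = adjMatrix Γ} (determines-⊤-wcab Γ w~c a~b w≁a w≁b w≢a w≢b) v indep v∈ker)
  (∣⊤-wcab∣≤n∸4 Γ w~c a~b w≁a w≁b w≢a w≢b)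
  where
  open InducedK₁∪K₂ H
  neighbour : Σ (Fin n) λ c → adj (graph Γ) w c ≡ true
  neighbour = reach⇒neighbour (connected w a) w≢a
  w~c : adj (graph Γ) w (proj₁ neighbour) ≡ true
  w~c = proj₂ neighbour

-- Attaching pendant vertices

_++ᴿ_ : ∀ {n} {G : Graph n} {i j k} → Reach G i j → Reach G j k → Reach G i k
here     ++ᴿ r′ = r′
step e r ++ᴿ r′ = step e (r ++ᴿ r′)

module _ {n} (a : Fin n) where

  attachGraph : Graph n → Graph (suc n)
  attachGraph G = record { adj = adj′ ; sym = sym′ ; irrefl = irrefl′ }
    where
    adj′ : Fin (suc n) → Fin (suc n) → Bool
    adj′ zero    zero    = false
    adj′ zero    (suc j) = does (j Fin.≟ a)
    adj′ (suc i) zero    = does (i Fin.≟ a)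
    adj′ (suc i) (suc j) = adj G i j
    sym′ : ∀ i j → adj′ i j ≡ adj′ j i
    sym′ zero    zero    = refl
    sym′ zero    (suc j) = refl
    sym′ (suc i) zero    = refl
    sym′ (suc i) (suc j) = Graph.sym G i j
    irrefl′ : ∀ i → adj′ i i ≡ false
    irrefl′ zero    = refl
    irrefl′ (suc i) = irrefl G i

  attach : SignedGraph n → SignedGraph (suc n)
  attach Γ = record { graph = attachGraph (graph Γ) ; σ = σ′ ; σ-sym = σ′-sym }
    where
    σ′ : Fin (suc n) → Fin (suc n) → Sign
    σ′ (suc i) (suc j) = σ Γ i j
    σ′ _       _       = plus
    σ′-sym : ∀ i j → σ′ i j ≡ σ′ j i
    σ′-sym zero    zero    = refl
    σ′-sym zero    (suc j) = refl
    σ′-sym (suc i) zero    = refl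
    σ′-sym (suc i) (suc j) = σ-sym Γ i j

  bicyclic-attach : ∀ {G} → Bicyclic G → Bicyclic (attachGraph G)
  bicyclic-attach {G} (connected , edges) =
    connected′ , trans (cong (ℕ._+ edgeCount G) (∑ℕ-indicator a)) (cong suc edges)
    where
    a~new : T (does (a Fin.≟ a))
    a~new = subst T (sym (dec-true (a Fin.≟ a) refl)) _
    lift : ∀ {i j} → Reach G i j → Reach (attachGraph G) (suc i) (suc j)
    lift here       = here
    lift (step e r) = step e (lift r)
    connected′ : Connected (attachGraph G)
    connected′ zero    zero    = here
    connected′ zero    (suc j) = step a~new (lift (connected a j))
    connected′ (suc i) zero    = lift (connected i a) ++ᴿ step a~new here
    connected′ (suc i) (suc j) = lift (connected i j)

NegativeCycle : ∀ {n} → SignedGraph n → Set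
NegativeCycle {n} Γ = Σ (List (Fin n)) λ vs → IsCycle (graph Γ) vs × ¬ PositiveCycle Γ vs

negativeCycle⇒unbalanced : ∀ {n} {Γ : SignedGraph n} → NegativeCycle Γ → Unbalanced Γ
negativeCycle⇒unbalanced (vs , cycle , negative) balanced = negative (balanced vs cycle)

consecutive-map : ∀ {A B : Set} (f : A → B) xs →
  consecutive (List.map f xs) ≡ List.map (Product.map f f) (consecutive xs)
consecutive-map f []           = refl
consecutive-map f (x ∷ [])     = refl
consecutive-map f (x ∷ y ∷ xs) = cong ((f x , f y) ∷_) (consecutive-map f (y ∷ xs))

cycleEdges-map : ∀ {n m} (f : Fin n → Fin m) vs →
  cycleEdges (List.map f vs) ≡ List.map (Product.map f f) (cycleEdges vs)
cycleEdges-map f []       = refl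
cycleEdges-map f (v ∷ vs) =
  trans (cong consecutive (sym (ListP.map-++ f (v ∷ vs) [ v ]))) (consecutive-map f ((v ∷ vs) ++ [ v ]))

negCount-attach : ∀ {n} (a : Fin n) (Γ : SignedGraph n) es →
  negCount (attach a Γ) (List.map (Product.map suc suc) es) ≡ negCount Γ es
negCount-attach a Γ []             = refl
negCount-attach a Γ ((i , j) ∷ es) with σ Γ i j
... | plus  = negCount-attach a Γ es
... | minus = cong suc (negCount-attach a Γ es)

negativeCycle-attach : ∀ {n} (a : Fin n) {Γ : SignedGraph n} → NegativeCycle Γ → NegativeCycle (attach a Γ)
negativeCycle-attach a {Γ} (vs , (3≤length , unique , edges) , negative) =
  List.map suc vs ,
  (subst (3 ≤_) (sym (ListP.length-map suc vs)) 3≤length ,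
   UniqueP.map⁺ suc-injective unique ,
   subst (All (IsEdge (graph (attach a Γ)))) (sym (cycleEdges-map suc vs)) (AllP.map⁺ edges)) ,
  negative ∘ subst (λ m → m ℕ.% 2 ≡ 0) negCount≡
  where
  negCount≡ : negCount (attach a Γ) (cycleEdges (List.map suc vs)) ≡ negCount Γ (cycleEdges vs)
  negCount≡ = trans (cong (negCount (attach a Γ)) (cycleEdges-map suc vs)) (negCount-attach a Γ (cycleEdges vs))

record Pendant {n} (Γ : SignedGraph n) (a b : Fin n) : Set where
  field
    edge     : adj (graph Γ) b a ≡ true
    positive : σ Γ b a ≡ plus
    only     : ∀ j → adj (graph Γ) b j ≡ true → j ≡ a

pendant⇒zero : ∀ {n} {Γ : SignedGraph n} {a b x} → Pendant Γ a b → InKernel (adjMatrix Γ) x → x a ≡ 0ℚ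
pendant⇒zero {Γ = Γ} {a} {b} pendant x∈ker = kernel-pivot Γ x∈ker edge λ j j≢a → inj₁ (nonNeighbour j j≢a)
  where
  open Pendant pendant
  nonNeighbour : ∀ j → j ≢ a → adj (graph Γ) b j ≡ false
  nonNeighbour j j≢a with adj (graph Γ) b j in b~j
  ... | true  = contradiction (only j b~j) j≢a
  ... | false = refl

pendant-attach : ∀ {n} (a : Fin n) (Γ : SignedGraph n) → Pendant (attach a Γ) (suc a) zero
pendant-attach a Γ = record { edge = dec-true (a Fin.≟ a) refl ; positive = refl ; only = only }
  where
  only : ∀ j → adj (graph (attach a Γ)) zero j ≡ true → j ≡ suc a
  only (suc j) j~a with j Fin.≟ a
  ... | yes refl = refl

module _ {n} (a : Fin n) (Γ : SignedGraph n) where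

  private
    A : Fin n → Fin n → ℤ
    A  = adjMatrix Γ
    A′ : Fin (suc n) → Fin (suc n) → ℤ
    A′ = adjMatrix (attach a Γ)

    scale : ∀ b q → ((if b then signℤ plus else 0ℤ) ℚ./ 1) * q ≡ (if b then q else 0ℚ)
    scale true  q = ℚP.*-identityˡ q
    scale false q = ℚP.*-zeroˡ q

  attach-row-zero : ∀ x → mulVec A′ x zero ≡ x (suc a)
  attach-row-zero x = begin
    mulVec A′ x zero                                     ≡⟨ cong (_+ ∑ℚ row) (ℚP.*-zeroˡ (x zero)) ⟩
    0ℚ + ∑ℚ row                                          ≡⟨ ℚP.+-identityˡ (∑ℚ row) ⟩
    ∑ℚ row                                               ≡⟨ ∑ℚ-cong (λ j → scale (does (j Fin.≟ a)) (x (suc j))) ⟩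
    ∑ℚ (λ j → if does (j Fin.≟ a) then x (suc j) else 0ℚ) ≡⟨ ∑ℚ-indicator a (x ∘ suc) ⟩
    x (suc a)                                            ∎
    where
    open ≡-Reasoning
    row : Fin n → ℚ
    row j = (A′ zero (suc j) ℚ./ 1) * x (suc j)

  attach-row-suc : ∀ x r → mulVec A′ x (suc r) ≡ (if does (r Fin.≟ a) then x zero else 0ℚ) + mulVec A (x ∘ suc) r
  attach-row-suc x r = cong (_+ mulVec A (x ∘ suc) r) (scale (does (r Fin.≟ a)) (x zero))

  attach-row-suc₀ : ∀ x → x zero ≡ 0ℚ → ∀ r → mulVec A′ x (suc r) ≡ mulVec A (x ∘ suc) r
  attach-row-suc₀ x x₀≡0 r =
    trans (attach-row-suc x r) (trans (cong (_+ mulVec A (x ∘ suc) r) (vanish (does (r Fin.≟ a)))) (ℚP.+-identityˡ _))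
    where
    vanish : ∀ b → (if b then x zero else 0ℚ) ≡ 0ℚ
    vanish true  = x₀≡0
    vanish false = refl

module _ {n k : ℕ} {Γ : SignedGraph n} {a b : Fin n} (pendant : Pendant Γ a b) where

  private
    open Pendant pendant
    A : Fin n → Fin n → ℤ
    A  = adjMatrix Γ
    A′ : Fin (suc n) → Fin (suc n) → ℤ
    A′ = adjMatrix (attach a Γ)

    a≢b : a ≢ b
    a≢b refl = not-¬ edge (irrefl (graph Γ) a)

    twin : Vecℚ (suc n)
    twin zero    = 1ℚ
    twin (suc j) = if does (j Fin.≟ b) then - 1ℚ else 0ℚ

    twin-inKernel : InKernel A′ twin
    twin-inKernel zero    = trans (attach-row-zero a Γ twin) (cong (if_then - 1ℚ else 0ℚ) (dec-false (a Fin.≟ b) a≢b))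
    twin-inKernel (suc r) = begin
      mulVec A′ twin (suc r)              ≡⟨ attach-row-suc a Γ twin r ⟩
      δ r a + mulVec A (twin ∘ suc) r     ≡⟨ cong (δ r a +_) column-b ⟩
      δ r a + (A r b ℚ./ 1) * - 1ℚ        ≡⟨ cancel ⟩
      0ℚ                                  ∎
      where
      open ≡-Reasoning
      column-b : mulVec A (twin ∘ suc) r ≡ (A r b ℚ./ 1) * - 1ℚ
      column-b = trans (∑ℚ-cong (sym ∘ push)) (∑ℚ-indicator b (λ j → (A r j ℚ./ 1) * - 1ℚ))
        where
        push : ∀ j → (if does (j Fin.≟ b) then (A r j ℚ./ 1) * - 1ℚ else 0ℚ) ≡ (A r j ℚ./ 1) * twin (suc j)
        push j with does (j Fin.≟ b)
        ... | true  = refl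
        ... | false = sym (ℚP.*-zeroʳ (A r j ℚ./ 1))
      nonNeighbour : r ≢ a → adj (graph Γ) r b ≡ false
      nonNeighbour r≢a with adj (graph Γ) r b in r~b
      ... | true  = contradiction (only r (adj-sym (graph Γ) r~b)) r≢a
      ... | false = refl
      cancel : (if does (r Fin.≟ a) then 1ℚ else 0ℚ) + (A r b ℚ./ 1) * - 1ℚ ≡ 0ℚ
      cancel with r Fin.≟ a
      ... | yes refl = cong (λ e → 1ℚ + (e ℚ./ 1) * - 1ℚ)
                         (trans (entry-adjacent Γ (adj-sym (graph Γ) edge)) (cong signℤ (trans (σ-sym Γ a b) positive)))
      ... | no r≢a   = cong (λ e → 0ℚ + (e ℚ./ 1) * - 1ℚ) (entry-nonAdjacent Γ (nonNeighbour r≢a))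

  twin-certificate : NullityCertificate A k → NullityCertificate A′ (suc k)
  twin-certificate C = record
    { basis       = basis′
    ; independent = independent′
    ; inKernel    = inKernel′
    ; support     = inside ∷ support
    ; ∣support∣≤k = s≤s ∣support∣≤k
    ; determines  = determines′
    }
    where
    open NullityCertificate C
    basis′ : Fin (suc k) → Vecℚ (suc n)
    basis′ zero    = twin
    basis′ (suc i) = 0ℚ ∷ᶠ basis i

    inKernel′ : ∀ i → InKernel A′ (basis′ i)
    inKernel′ zero            = twin-inKernel
    inKernel′ (suc i) zero    = trans (attach-row-zero a Γ (basis′ (suc i))) (pendant⇒zero pendant (inKernel i))
    inKernel′ (suc i) (suc r) = trans (attach-row-suc₀ a Γ (basis′ (suc i)) refl r) (inKernel i r)

    independent′ : LinIndep basis′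
    independent′ c vanish = λ { zero → c₀≡0 ; (suc i) → independent (c ∘ suc) vanish′ i }
      where
      open ≡-Reasoning
      c₀≡0 : c zero ≡ 0ℚ
      c₀≡0 = begin
        c zero                        ≡⟨ ℚP.*-identityʳ (c zero) ⟨
        c zero * 1ℚ                   ≡⟨ ℚP.+-identityʳ (c zero * 1ℚ) ⟨
        c zero * 1ℚ + 0ℚ              ≡⟨ cong (c zero * 1ℚ +_) (∑ℚ-zero (λ i → ℚP.*-zeroʳ (c (suc i)))) ⟨
        combination c basis′ zero     ≡⟨ vanish zero ⟩
        0ℚ                            ∎
      vanish′ : ∀ j → combination (c ∘ suc) basis j ≡ 0ℚ
      vanish′ j = begin
        combination (c ∘ suc) basis j            ≡⟨ ℚP.+-identityˡ (combination (c ∘ suc) basis j) ⟨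
        0ℚ + combination (c ∘ suc) basis j       ≡⟨ cong (_+ combination (c ∘ suc) basis j) c₀-term ⟨
        combination c basis′ (suc j)             ≡⟨ vanish (suc j) ⟩
        0ℚ                                       ∎
        where
        c₀-term : c zero * twin (suc j) ≡ 0ℚ
        c₀-term = trans (cong (_* twin (suc j)) c₀≡0) (ℚP.*-zeroˡ (twin (suc j)))

    determines′ : Determines A′ (inside ∷ support)
    determines′ x x∈ker x|S≡0 = λ { zero → x₀≡0 ; (suc j) → tail≡0 j }
      where
      x₀≡0 : x zero ≡ 0ℚ
      x₀≡0 = x|S≡0 zero here
      tail≡0 : ∀ j → x (suc j) ≡ 0ℚ
      tail≡0 = determines (x ∘ suc) (λ r → trans (sym (attach-row-suc₀ a Γ x x₀≡0 r)) (x∈ker (suc r)))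
                 (λ j j∈S → x|S≡0 (suc j) (there j∈S))

module _ {n k : ℕ} (a : Fin n) (Γ : SignedGraph n) where

  private
    Γ₁ : SignedGraph (suc n)
    Γ₁ = attach a Γ
    A : Fin n → Fin n → ℤ
    A  = adjMatrix Γ
    A₁ : Fin (suc n) → Fin (suc n) → ℤ
    A₁ = adjMatrix Γ₁
    A₂ : Fin (suc (suc n)) → Fin (suc (suc n)) → ℤ
    A₂ = adjMatrix (attach zero Γ₁)

    row₂-suc-suc : ∀ x r → mulVec A₂ x (suc (suc r)) ≡ mulVec A₁ (x ∘ suc) (suc r)
    row₂-suc-suc x r = trans (attach-row-suc zero Γ₁ x (suc r)) (ℚP.+-identityˡ (mulVec A₁ (x ∘ suc) (suc r)))

    row₂-one : ∀ x → mulVec A₂ x (suc zero) ≡ x zero + x (suc (suc a))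
    row₂-one x = trans (attach-row-suc zero Γ₁ x zero) (cong (x zero +_) (attach-row-zero a Γ (x ∘ suc)))

  path-certificate : NullityCertificate A k → NullityCertificate A₂ k
  path-certificate C = record
    { basis       = basis″
    ; independent = λ c vanish → independent c (λ j → vanish (suc (suc j)))
    ; inKernel    = inKernel″
    ; support     = outside ∷ outside ∷ support
    ; ∣support∣≤k = ∣support∣≤k
    ; determines  = determines″
    }
    where
    open NullityCertificate C
    basis″ : Fin k → Vecℚ (suc (suc n))
    basis″ i = (- basis i a) ∷ᶠ 0ℚ ∷ᶠ basis i

    inKernel″ : ∀ i → InKernel A₂ (basis″ i)
    inKernel″ i zero          = attach-row-zero zero Γ₁ (basis″ i)
    inKernel″ i (suc zero)    = trans (row₂-one (basis″ i)) (ℚP.+-inverseˡ (basis i a))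
    inKernel″ i (suc (suc r)) =
      trans (row₂-suc-suc (basis″ i) r) (trans (attach-row-suc₀ a Γ (basis″ i ∘ suc) refl r) (inKernel i r))

    determines″ : Determines A₂ (outside ∷ outside ∷ support)
    determines″ x x∈ker x|S≡0 = λ { zero → x₀≡0 ; (suc zero) → x₁≡0 ; (suc (suc j)) → y≡0 j }
      where
      open ≡-Reasoning
      y : Vecℚ n
      y j = x (suc (suc j))
      x₁≡0 : x (suc zero) ≡ 0ℚ
      x₁≡0 = trans (sym (attach-row-zero zero Γ₁ x)) (x∈ker zero)
      y∈ker : InKernel A y
      y∈ker r = begin
        mulVec A y r                    ≡⟨ attach-row-suc₀ a Γ (x ∘ suc) x₁≡0 r ⟨
        mulVec A₁ (x ∘ suc) (suc r)     ≡⟨ row₂-suc-suc x r ⟨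
        mulVec A₂ x (suc (suc r))       ≡⟨ x∈ker (suc (suc r)) ⟩
        0ℚ                              ∎
      y≡0 : ∀ j → y j ≡ 0ℚ
      y≡0 = determines y y∈ker (λ j j∈S → x|S≡0 (suc (suc j)) (there (there j∈S)))
      x₀≡0 : x zero ≡ 0ℚ
      x₀≡0 = begin
        x zero                          ≡⟨ ℚP.+-identityʳ (x zero) ⟨
        x zero + 0ℚ                     ≡⟨ cong (x zero +_) (y≡0 a) ⟨
        x zero + x (suc (suc a))        ≡⟨ row₂-one x ⟨
        mulVec A₂ x (suc zero)          ≡⟨ x∈ker (suc zero) ⟩
        0ℚ                              ∎

-- The realizing graphs

record Realization (n k : ℕ) : Set where
  field
    Γ        : SignedGraph n
    bicyclic : Bicyclic (graph Γ)
    negative : NegativeCycle Γ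
    nullity  : NullityCertificate (adjMatrix Γ) k
    hub leaf : Fin n
    pendant  : Pendant Γ hub leaf

realization-attach : ∀ {n k} (a : Fin n) {Γ : SignedGraph n} → Bicyclic (graph Γ) → NegativeCycle Γ →
  NullityCertificate (adjMatrix (attach a Γ)) k → Realization (suc n) k
realization-attach a {Γ} bicyclic negative nullity = record
  { Γ        = attach a Γ
  ; bicyclic = bicyclic-attach a bicyclic
  ; negative = negativeCycle-attach a negative
  ; nullity  = nullity
  ; hub      = suc a
  ; leaf     = zero
  ; pendant  = pendant-attach a Γ
  }

attachTwin : ∀ {n k} → Realization n k → Realization (suc n) (suc k)
attachTwin R = realization-attach hub bicyclic negative (twin-certificate pendant nullity)
  where open Realization R

attachPath : ∀ {n k} → Realization n k → Realization (suc (suc n)) k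
attachPath R = realization-attach zero (bicyclic-attach hub bicyclic) (negativeCycle-attach hub negative)
  (path-certificate hub Γ nullity)
  where open Realization R

attachTwins : ∀ j {n k} → Realization n k → Realization (j ℕ.+ n) (j ℕ.+ k)
attachTwins zero    R = R
attachTwins (suc j) R = attachTwin (attachTwins j R)

diamond : SignedGraph 4
diamond = record
  { graph = record
    { adj    = λ i j → edge i j ∨ edge j i
    ; sym    = λ i j → ∨-comm (edge i j) (edge j i)
    ; irrefl = irrefl′
    }
  ; σ     = λ i j → if negative i j ∨ negative j i then minus else plus
  ; σ-sym = λ i j → cong (if_then minus else plus) (∨-comm (negative i j) (negative j i))
  }
  where
  edge negative : Fin 4 → Fin 4 → Bool
  edge 0F 1F = true
  edge 0F 2F = true
  edge 0F 3F = true
  edge 1F 2F = true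
  edge 1F 3F = true
  edge _  _  = false
  negative 1F 2F = true
  negative 1F 3F = true
  negative _  _  = false
  irrefl′ : ∀ i → edge i i ∨ edge i i ≡ false
  irrefl′ 0F = refl
  irrefl′ 1F = refl
  irrefl′ 2F = refl
  irrefl′ 3F = refl

diamond-bicyclic : Bicyclic (graph diamond)
diamond-bicyclic = (λ i j → toHub i ++ᴿ fromHub j) , refl
  where
  toHub : ∀ i → Reach (graph diamond) i 0F
  toHub 0F = here
  toHub 1F = step _ here
  toHub 2F = step _ here
  toHub 3F = step _ here
  fromHub : ∀ j → Reach (graph diamond) 0F j
  fromHub 0F = here
  fromHub 1F = step _ here
  fromHub 2F = step _ here
  fromHub 3F = step _ here

diamond-negative : NegativeCycle diamond
diamond-negative =
  (0F ∷ 1F ∷ 2F ∷ []) ,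
  (s≤s (s≤s (s≤s z≤n)) , ((λ ()) ∷ (λ ()) ∷ []) ∷ ((λ ()) ∷ []) ∷ [] ∷ [] , _ ∷ _ ∷ _ ∷ []) ,
  λ ()

-- No pivot order exists here: it would make r ↦ c the only permutation contributing to the
-- determinant, hence by symmetry a fixed-point-free involution of 5 vertices. So an explicit inverse
-- is checked instead.
diamond₅ : Realization 5 0
diamond₅ = realization-attach 2F diamond-bicyclic diamond-negative
  (determines⊥⇒certificate (leftInverse⇒determines inverse A (toWitness {a? = isLeftInverse? inverse A} _)))
  where
  A : Fin 5 → Fin 5 → ℤ
  A = adjMatrix (attach 2F diamond)
  inverse : Fin 5 → Fin 5 → ℚ
  inverse i j = lookup (lookup rows i) j
    where
    rows : Vec (Vec ℚ 5) 5
    rows = (0ℚ   ∷ 0ℚ ∷ 0ℚ  ∷ 1ℚ ∷ - 1ℚ ∷ [])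
         ∷ (0ℚ   ∷ ½  ∷ ½   ∷ 0ℚ ∷ ½    ∷ [])
         ∷ (0ℚ   ∷ ½  ∷ ½   ∷ 0ℚ ∷ - ½  ∷ [])
         ∷ (1ℚ   ∷ 0ℚ ∷ 0ℚ  ∷ 0ℚ ∷ 0ℚ   ∷ [])
         ∷ (- 1ℚ ∷ ½  ∷ - ½ ∷ 0ℚ ∷ ½    ∷ [])
         ∷ []

-- Diamond vertices 2 and 3 (here 3F and 4F) are twins, so their difference u lies in the kernel.
diamond₅′ : Realization 5 1
diamond₅′ = realization-attach 0F diamond-bicyclic diamond-negative record
  { basis       = λ _ → u
  ; independent = λ c vanish → λ
      { zero → trans (sym (trans (ℚP.+-identityʳ _) (ℚP.*-identityʳ (c zero)))) (vanish 3F) }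
  ; inKernel    = λ _ → toWitness {a? = all? (λ r → mulVec A u r ℚP.≟ 0ℚ)} _
  ; support     = ⁅ 3F ⁆
  ; ∣support∣≤k = ℕP.≤-refl
  ; determines  = pivots⇒determines (attach 0F diamond) ⁅ 3F ⁆
                    ((0F , 1F) ∷ (2F , 4F) ∷ (3F , 2F) ∷ (1F , 0F) ∷ []) _
  }
  where
  A : Fin 5 → Fin 5 → ℤ
  A = adjMatrix (attach 0F diamond)
  u : Vecℚ 5
  u = lookup (0ℚ ∷ 0ℚ ∷ 0ℚ ∷ 1ℚ ∷ - 1ℚ ∷ [])

diamond₆ : Realization 6 0
diamond₆ = realization-attach 3F bicyclic negative (determines⊥⇒certificate (pivots⇒determines (attach 3F Γ) ⊥
  ((1F , 2F) ∷ (0F , 4F) ∷ (3F , 5F) ∷ (5F , 3F) ∷ (2F , 1F) ∷ (4F , 0F) ∷ []) _))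
  where open Realization diamond₅′

nonsingular : ∀ m → Realization (5 ℕ.+ m) 0
nonsingular zero          = diamond₅
nonsingular (suc zero)    = diamond₆
nonsingular (suc (suc m)) = attachPath (nonsingular m)

realization : ∀ {n k} → 8 ≤ n → k ≤ n ∸ 4 → Realization n k
realization {n} {k} 8≤n k≤n∸4 with ℕP.m≤n⇒∃[o]m+o≡n (ℕP.m≤o∸n⇒m+n≤o k (ℕP.≤-trans (ℕP.m≤m+n 4 4) 8≤n) k≤n∸4)
... | suc m , refl = subst₂ Realization (shift k m) (ℕP.+-identityʳ k) (attachTwins k (nonsingular m))
  where
  shift : ∀ k m → k ℕ.+ (5 ℕ.+ m) ≡ k ℕ.+ 4 ℕ.+ suc m
  shift = solve-∀
... | zero , refl with k | 8≤n
...   | zero   | s≤s (s≤s (s≤s (s≤s ())))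
...   | suc k′ | _ = subst₂ Realization (shift k′) (ℕP.+-comm k′ 1) (attachTwins k′ diamond₅′)
  where
  shift : ∀ k → k ℕ.+ 5 ≡ suc k ℕ.+ 4 ℕ.+ 0
  shift = solve-∀

theorem5p8 : (n : ℕ) → 8 ≤ n → (k : ℕ) →
    (Σ (SignedGraph n) (λ Γ → Bicyclic (graph Γ) × Unbalanced Γ × Nullity Γ k))
    ⇔ (k ≤ n ∸ 4)
theorem5p8 n 8≤n k = mk⇔
  (λ (Γ , bicyclic , _ , nullity) → nullity≤n∸4 Γ 8≤n bicyclic nullity)
  (λ k≤n∸4 → let open Realization (realization 8≤n k≤n∸4) in
    Γ , bicyclic , negativeCycle⇒unbalanced negative , certificate⇒kernelDim nullity)
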